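{- The comparator circuit value problem $\textsc{Ccv}$ is $\mathsf{AC}^0$ many-one reducible to the special case of $\textsc{Ccv}$ in which all comparator gates point down (and likewise to the special case in which all comparator gates point up).
   Context: A comparator circuit has wires $w_0,\dots,w_{m-1}$ (drawn top to bottom) and a sequence of comparator gates; a gate on wires $w_i,w_j$ with inputs $p$ (on the wire where the minimum goes) and $q$ replaces the values by $p\wedge q$ on one wire and $p\vee q$ on the other wire (the wire the arrow points to). A gate points down if the wire receiving $p\vee q$ has larger index than the wire receiving $p\wedge q$, and points up otherwise. $\textsc{Ccv}$ is the decision problem: given a comparator circuit, an assignment of a Boolean value to the input (left end) of each wire, and a designated wire, decide whether the designated wire outputs $1$. A relation $R_1$ is $\mathsf{AC}^0$ many-one reducible to $R_2$ if there is a function $F$ computable by uniform $\mathsf{AC}^0$ circuits (with $|F(X)|$ polynomially bounded) such that $R_1(X)\leftrightarrow R_2(F(X))$. -}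

module Defs where

open import Data.Nat using (ℕ; zero; suc; _+_; _*_; _≤_; _<_)
open import Data.Bool using (Bool; true; false; _∧_; _∨_)
open import Data.List using (List; []; _∷_; length; foldl)
import Data.List as List
open import Data.List.Relation.Unary.All using (All)
open import Data.Fin using (Fin; toℕ; fromℕ<; _≟_)
open import Data.Vec using (Vec; []; _∷_; lookup)
open import Data.Product using (Σ; _×_; _,_; proj₁; proj₂)
open import Data.Sum using (_⊎_)
open import Data.Unit using (⊤)
open import Relation.Nullary using (¬_; yes; no)
open import Relation.Binary.PropositionalEquality using (_≡_; _≢_)
open import Function.Bundles using (_⇔_)

-- Strings (Cook–Nguyen two-sorted setting): binary strings, with
-- bit i = false outside the list.

Str : Set
Str = List Bool

bit : Str → ℕ → Bool
bit []       _       = false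
bit (b ∷ _)  zero    = b
bit (_ ∷ bs) (suc i) = bit bs i

Input : ℕ → ℕ → Set
Input k l = Vec ℕ k × Vec Str l

-- Σ^B_0 formulas (bounded-quantifier formulas over 0,1,+,·,≤,=,X(t),|X|),
-- with v number variables in scope (de Bruijn), over an input signature k,l.

data Term (k l v : ℕ) : Set where
  var  : Fin v → Term k l v
  numI : Fin k → Term k l v
  len  : Fin l → Term k l v
  zro  : Term k l v
  one  : Term k l v
  _⊕_  : Term k l v → Term k l v → Term k l v
  _⊗_  : Term k l v → Term k l v → Term k l v

data Formula (k l : ℕ) : ℕ → Set where
  _≤f_ : ∀ {v} → Term k l v → Term k l v → Formula k l v
  _≡f_ : ∀ {v} → Term k l v → Term k l v → Formula k l v
  mem  : ∀ {v} → Fin l → Term k l v → Formula k l v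
  ¬f   : ∀ {v} → Formula k l v → Formula k l v
  _∧f_ : ∀ {v} → Formula k l v → Formula k l v → Formula k l v
  _∨f_ : ∀ {v} → Formula k l v → Formula k l v → Formula k l v
  ∀≤   : ∀ {v} → Term k l v → Formula k l (suc v) → Formula k l v
  ∃≤   : ∀ {v} → Term k l v → Formula k l (suc v) → Formula k l v

⟦_⟧T : ∀ {k l v} → Term k l v → Input k l → Vec ℕ v → ℕ
⟦ var x  ⟧T inp ρ = lookup ρ x
⟦ numI i ⟧T inp ρ = lookup (proj₁ inp) i
⟦ len j  ⟧T inp ρ = length (lookup (proj₂ inp) j)
⟦ zro    ⟧T inp ρ = 0
⟦ one    ⟧T inp ρ = 1
⟦ s ⊕ t  ⟧T inp ρ = ⟦ s ⟧T inp ρ + ⟦ t ⟧T inp ρ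
⟦ s ⊗ t  ⟧T inp ρ = ⟦ s ⟧T inp ρ * ⟦ t ⟧T inp ρ

⟦_⟧F : ∀ {k l v} → Formula k l v → Input k l → Vec ℕ v → Set
⟦ s ≤f t   ⟧F inp ρ = ⟦ s ⟧T inp ρ ≤ ⟦ t ⟧T inp ρ
⟦ s ≡f t   ⟧F inp ρ = ⟦ s ⟧T inp ρ ≡ ⟦ t ⟧T inp ρ
⟦ mem j t  ⟧F inp ρ = bit (lookup (proj₂ inp) j) (⟦ t ⟧T inp ρ) ≡ true
⟦ ¬f φ     ⟧F inp ρ = ¬ ⟦ φ ⟧F inp ρ
⟦ φ ∧f ψ   ⟧F inp ρ = ⟦ φ ⟧F inp ρ × ⟦ ψ ⟧F inp ρ
⟦ φ ∨f ψ   ⟧F inp ρ = ⟦ φ ⟧F inp ρ ⊎ ⟦ ψ ⟧F inp ρ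
⟦ ∀≤ t φ   ⟧F inp ρ = (x : ℕ) → x ≤ ⟦ t ⟧T inp ρ → ⟦ φ ⟧F inp (x ∷ ρ)
⟦ ∃≤ t φ   ⟧F inp ρ = Σ ℕ λ x → x ≤ ⟦ t ⟧T inp ρ × ⟦ φ ⟧F inp (x ∷ ρ)

-- AC0 functions (Cook–Nguyen; equivalent to FO/DLOGTIME-uniform AC0).
-- Number function f: f ≤ t(x̄,|X̄|) and  f(x̄,X̄) = y ↔ y ≤ t ∧ φ(y,x̄,X̄).
AC0Num : ∀ {k l} → (Input k l → ℕ) → Set
AC0Num {k} {l} f =
  Σ (Term k l 0) λ t → Σ (Formula k l 1) λ φ →
    ∀ inp → f inp ≤ ⟦ t ⟧T inp [] ×
            (∀ y → (f inp ≡ y) ⇔ (y ≤ ⟦ t ⟧T inp [] × ⟦ φ ⟧F inp (y ∷ [])))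

AC0Str : ∀ {k l} → (Input k l → Str) → Set
AC0Str {k} {l} F =
  Σ (Term k l 0) λ t → Σ (Formula k l 1) λ φ →
    ∀ inp → length (F inp) ≤ ⟦ t ⟧T inp [] ×
            (∀ i → (bit (F inp) i ≡ true) ⇔ (i < ⟦ t ⟧T inp [] × ⟦ φ ⟧F inp (i ∷ [])))

IsAC0 : ∀ {k l k' l'} → (Input k l → Input k' l') → Set
IsAC0 {k' = k'} {l' = l'} F =
  ((i : Fin k') → AC0Num (λ inp → lookup (proj₁ (F inp)) i)) ×
  ((j : Fin l') → AC0Str (λ inp → lookup (proj₂ (F inp)) j))

_≤AC0_ : ∀ {k l k' l'} → (Input k l → Set) → (Input k' l' → Set) → Set
_≤AC0_ {k} {l} {k'} {l'} R₁ R₂ =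
  Σ (Input k l → Input k' l') λ F → IsAC0 F × (∀ inp → R₁ inp ⇔ R₂ (F inp))

record Gate (m : ℕ) : Set where
  constructor gate
  field
    minW     : Fin m
    maxW     : Fin m
    distinct : minW ≢ maxW
open Gate public

PointsDown : ∀ {m} → Gate m → Set
PointsDown g = toℕ (minW g) < toℕ (maxW g)

PointsUp : ∀ {m} → Gate m → Set
PointsUp g = toℕ (maxW g) < toℕ (minW g)

applyGate : ∀ {m} → Gate m → (Fin m → Bool) → (Fin m → Bool)
applyGate g v w with w ≟ minW g
... | yes _ = v (minW g) ∧ v (maxW g)
... | no  _ with w ≟ maxW g
...   | yes _ = v (minW g) ∨ v (maxW g)
...   | no  _ = v w

run : ∀ {m} → List (Gate m) → (Fin m → Bool) → (Fin m → Bool)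
run gs v = foldl (λ acc g → applyGate g acc) v gs

-- Encoding of a Ccv instance (Cook–Nguyen style): number inputs (m, n, d),
-- string inputs (I, G).  m = #wires, n = #gates, d = designated wire,
-- I(i) = input value of wire i (i < m), and for each k < n,
-- G(⟨k,⟨a,b⟩⟩) holds iff gate k sends the minimum to wire a and the
-- maximum to wire b.  ⟨x,y⟩ is the Cantor pairing function.

tri : ℕ → ℕ
tri zero    = 0
tri (suc s) = suc s + tri s

⟨_,_⟩ : ℕ → ℕ → ℕ
⟨ x , y ⟩ = tri (x + y) + y

GatesEncoded : ∀ {m} → Str → List (Gate m) → Set
GatesEncoded G gs =
  (k : Fin (length gs)) (a b : ℕ) →
    (bit G ⟨ toℕ k , ⟨ a , b ⟩ ⟩ ≡ true) ⇔
    (toℕ (minW (List.lookup gs k)) ≡ a × toℕ (maxW (List.lookup gs k)) ≡ b)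

CcvWith : (∀ {m} → Gate m → Set) → Input 3 2 → Set
CcvWith P ((m ∷ n ∷ d ∷ []) , (I ∷ G ∷ [])) =
  Σ (d < m) λ d<m → Σ (List (Gate m)) λ gs →
    length gs ≡ n × GatesEncoded G gs × All P gs ×
    run gs (λ w → bit I (toℕ w)) (fromℕ< d<m) ≡ true

Ccv : Input 3 2 → Set
Ccv = CcvWith (λ _ → ⊤)

Ccv↓ : Input 3 2 → Set
Ccv↓ = CcvWith PointsDown

Ccv↑ : Input 3 2 → Set
Ccv↑ = CcvWith PointsUp

-- Each gate (a , b) is replaced by four gates joining a or b to one of two fresh wires
-- reserved for that gate, one holding 1 and one holding 0; together they leave a ∧ b on a
-- and a ∨ b on b.  In each of the four gates the 1-wire is on the min side and the 0-wire
-- on the max side, so with the original wires in the middle, the 1-wires above and the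
-- 0-wires below them (or vice versa), all gates point down (up).  The new circuit and
-- input are Σ^B_0-definable from the old ones via Cantor pairing, and an input that
-- encodes no circuit is sent to a no-instance.

module Submission where

open import Defs
open import Data.Bool using (Bool; true; false; _∧_; _∨_; if_then_else_)
open import Data.Bool.Properties using (∧-identityˡ; ∨-identityʳ)
import Data.Bool.Properties as Bool
open import Data.Empty using (⊥-elim)
open import Data.Fin using (Fin; toℕ; fromℕ<)
import Data.Fin as Fin
open import Data.Fin.Patterns using (0F; 1F; 2F; 3F)
open import Data.Fin.Properties using (toℕ-fromℕ<; toℕ-injective; toℕ<n; toℕ≤pred[n])
open import Data.List using (List; []; _∷_; length; _++_; map; applyUpTo)
import Data.List as List
open import Data.List.Properties using (length-applyUpTo; length-map)
open import Data.List.Relation.Unary.All using (All; []; _∷_)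
import Data.List.Relation.Unary.All as All
open import Data.Maybe using (Maybe; just; nothing)
open import Data.Nat using (ℕ; zero; suc; _+_; _*_; _≤_; _<_; z≤n; s≤s; ⌊_/2⌋)
open import Data.Nat.Properties
open import Data.Nat.Tactic.RingSolver using (solve-∀)
open import Data.Product using (Σ; _×_; _,_; proj₁; proj₂)
open import Data.Product.Properties using (×-≡,≡→≡; ×-≡,≡←≡)
open import Data.Sum using (_⊎_; inj₁; inj₂)
open import Data.Unit using (tt)
open import Data.Vec using (Vec; []; _∷_; lookup)
open import Function.Base using (id)
open import Function.Bundles using (_⇔_; mk⇔; Equivalence)
import Function.Properties.Equivalence as ⇔
open import Relation.Binary.Definitions using (tri<; tri≈; tri>)
open import Relation.Binary.PropositionalEquality
open import Relation.Nullary using (¬_; Dec; yes; no; does)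
open import Relation.Nullary.Decidable using (dec-true)
import Relation.Nullary.Decidable as Dec

open Equivalence using (to; from)

private
  variable
    k l v : ℕ

pattern #0 = Fin.zero
pattern #1 = Fin.suc #0
pattern #2 = Fin.suc #1
pattern #3 = Fin.suc #2
pattern #4 = Fin.suc #3
pattern #5 = Fin.suc #4

-- Decidability of bounded formulas

∀≤? : {P : ℕ → Set} → (∀ x → Dec (P x)) → ∀ b → Dec ((x : ℕ) → x ≤ b → P x)
∀≤? P? zero = Dec.map′ (λ { p zero _ → p }) (λ f → f 0 z≤n) (P? 0)
∀≤? P? (suc b) =
  Dec.map′ (λ { (p , f) zero _ → p ; (p , f) (suc x) (s≤s x≤b) → f x x≤b })
           (λ f → f 0 z≤n , λ x x≤b → f (suc x) (s≤s x≤b))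
           (P? 0 Dec.×-dec ∀≤? (λ x → P? (suc x)) b)

∃≤? : {P : ℕ → Set} → (∀ x → Dec (P x)) → ∀ b → Dec (Σ ℕ λ x → x ≤ b × P x)
∃≤? P? zero =
  Dec.map′ (λ p → 0 , z≤n , p) (λ { (zero , _ , p) → p }) (P? 0)
∃≤? P? (suc b) =
  Dec.map′ (λ { (inj₁ p) → 0 , z≤n , p ; (inj₂ (x , x≤b , p)) → suc x , s≤s x≤b , p })
           (λ { (zero , _ , p) → inj₁ p ; (suc x , s≤s x≤b , p) → inj₂ (x , x≤b , p) })
           (P? 0 Dec.⊎-dec ∃≤? (λ x → P? (suc x)) b)

⟦_⟧F? : (φ : Formula k l v) → ∀ inp ρ → Dec (⟦ φ ⟧F inp ρ)
⟦ s ≤f t  ⟧F? inp ρ = ⟦ s ⟧T inp ρ ≤? ⟦ t ⟧T inp ρ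
⟦ s ≡f t  ⟧F? inp ρ = ⟦ s ⟧T inp ρ ≟ ⟦ t ⟧T inp ρ
⟦ mem j t ⟧F? inp ρ = bit (lookup (proj₂ inp) j) (⟦ t ⟧T inp ρ) Bool.≟ true
⟦ ¬f φ    ⟧F? inp ρ = Dec.¬? (⟦ φ ⟧F? inp ρ)
⟦ φ ∧f ψ  ⟧F? inp ρ = ⟦ φ ⟧F? inp ρ Dec.×-dec ⟦ ψ ⟧F? inp ρ
⟦ φ ∨f ψ  ⟧F? inp ρ = ⟦ φ ⟧F? inp ρ Dec.⊎-dec ⟦ ψ ⟧F? inp ρ
⟦ ∀≤ t φ  ⟧F? inp ρ = ∀≤? (λ x → ⟦ φ ⟧F? inp (x ∷ ρ)) (⟦ t ⟧T inp ρ)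
⟦ ∃≤ t φ  ⟧F? inp ρ = ∃≤? (λ x → ⟦ φ ⟧F? inp (x ∷ ρ)) (⟦ t ⟧T inp ρ)

weaken : Term k l v → Term k l (suc v)
weaken (var x)  = var (Fin.suc x)
weaken (numI i) = numI i
weaken (len j)  = len j
weaken zro      = zro
weaken one      = one
weaken (s ⊕ t)  = weaken s ⊕ weaken t
weaken (s ⊗ t)  = weaken s ⊗ weaken t

⟦weaken⟧ : ∀ (t : Term k l v) inp ρ x → ⟦ weaken t ⟧T inp (x ∷ ρ) ≡ ⟦ t ⟧T inp ρ
⟦weaken⟧ (var _)  inp ρ x = refl
⟦weaken⟧ (numI _) inp ρ x = refl
⟦weaken⟧ (len _)  inp ρ x = refl
⟦weaken⟧ zro      inp ρ x = refl
⟦weaken⟧ one      inp ρ x = refl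
⟦weaken⟧ (s ⊕ t)  inp ρ x = cong₂ _+_ (⟦weaken⟧ s inp ρ x) (⟦weaken⟧ t inp ρ x)
⟦weaken⟧ (s ⊗ t)  inp ρ x = cong₂ _*_ (⟦weaken⟧ s inp ρ x) (⟦weaken⟧ t inp ρ x)

⟦weaken²⟧ : ∀ (t : Term k l v) inp ρ x y → ⟦ weaken (weaken t) ⟧T inp (x ∷ y ∷ ρ) ≡ ⟦ t ⟧T inp ρ
⟦weaken²⟧ t inp ρ x y = trans (⟦weaken⟧ (weaken t) inp (y ∷ ρ) x) (⟦weaken⟧ t inp ρ y)

numeral : ℕ → Term k l v
numeral zero    = zro
numeral (suc n) = one ⊕ numeral n

pairBound : Term k l v → Term k l v → Term k l v
pairBound x y = ((x ⊕ y) ⊗ (x ⊕ y)) ⊕ y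

⟦numeral⟧ : ∀ n inp (ρ : Vec ℕ v) → ⟦ numeral {k} {l} n ⟧T inp ρ ≡ n
⟦numeral⟧ zero    inp ρ = refl
⟦numeral⟧ (suc n) inp ρ = cong suc (⟦numeral⟧ n inp ρ)

term-AC0Num : (t : Term k l 0) → AC0Num (λ inp → ⟦ t ⟧T inp [])
term-AC0Num t = t , var #0 ≡f weaken t , λ inp → ≤-refl , λ y →
  mk⇔ (λ { refl → ≤-refl , sym (⟦weaken⟧ t inp [] y) })
      (λ (_ , y≡t) → sym (trans y≡t (⟦weaken⟧ t inp [] y)))

does-true : ∀ {P : Set} (P? : Dec P) → does P? ≡ true → P
does-true (yes p) _ = p

true-extensional : ∀ {x y : Bool} → (x ≡ true → y ≡ true) → (y ≡ true → x ≡ true) → x ≡ y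
true-extensional {false} {false} _ _ = refl
true-extensional {false} {true}  _ y⇒x = y⇒x refl
true-extensional {true}  {false} x⇒y _ = sym (x⇒y refl)
true-extensional {true}  {true}  _ _ = refl

bit-applyUpTo : ∀ (f : ℕ → Bool) T i → (bit (applyUpTo f T) i ≡ true) ⇔ (i < T × f i ≡ true)
bit-applyUpTo f zero    i       = mk⇔ (λ ()) (λ ())
bit-applyUpTo f (suc T) zero    = mk⇔ (λ fi → s≤s z≤n , fi) proj₂
bit-applyUpTo f (suc T) (suc i) = mk⇔
  (λ b → let (i<T , fi) = to (bit-applyUpTo (λ j → f (suc j)) T i) b in s≤s i<T , fi)
  (λ { (s≤s i<T , fi) → from (bit-applyUpTo (λ j → f (suc j)) T i) (i<T , fi) })

comprehension : Term k l 0 → Formula k l 1 → Input k l → Str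
comprehension t φ inp = applyUpTo (λ i → does (⟦ φ ⟧F? inp (i ∷ []))) (⟦ t ⟧T inp [])

bit-comprehension : ∀ (t : Term k l 0) φ inp i →
  (bit (comprehension t φ inp) i ≡ true) ⇔ (i < ⟦ t ⟧T inp [] × ⟦ φ ⟧F inp (i ∷ []))
bit-comprehension t φ inp i = mk⇔
  (λ b → let (i<t , φi) = to (bit-applyUpTo _ _ i) b in i<t , does-true (⟦ φ ⟧F? inp (i ∷ [])) φi)
  (λ (i<t , φi) → from (bit-applyUpTo _ _ i) (i<t , dec-true (⟦ φ ⟧F? inp (i ∷ [])) φi))

comprehension-AC0Str : (t : Term k l 0) (φ : Formula k l 1) → AC0Str (comprehension t φ)
comprehension-AC0Str t φ =
  t , φ , λ inp → ≤-reflexive (length-applyUpTo _ _) , bit-comprehension t φ inp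

ifHolds : (ψ : ∀ {v} → Formula k l v) → Term k l 0 → Input k l → ℕ
ifHolds ψ t inp = if does (⟦ ψ ⟧F? inp []) then ⟦ t ⟧T inp [] else 0

ifHolds-AC0Num : ∀ (ψ : ∀ {v} → Formula k l v) t →
  (∀ inp y → ⟦ ψ ⟧F inp (y ∷ []) ⇔ ⟦ ψ ⟧F inp []) → AC0Num (ifHolds ψ t)
ifHolds-AC0Num ψ t ψ-closed =
  t , (ψ ∧f (var #0 ≡f weaken t)) ∨f (¬f ψ ∧f (var #0 ≡f zro)) ,
  λ inp → spec inp (⟦ ψ ⟧F? inp [])
  where
  spec : ∀ inp (ψ? : Dec (⟦ ψ ⟧F inp [])) → let r = if does ψ? then ⟦ t ⟧T inp [] else 0 in
    r ≤ ⟦ t ⟧T inp [] × (∀ y → (r ≡ y) ⇔ (y ≤ ⟦ t ⟧T inp [] ×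
      ((⟦ ψ ⟧F inp (y ∷ []) × y ≡ ⟦ weaken t ⟧T inp (y ∷ [])) ⊎ (¬ ⟦ ψ ⟧F inp (y ∷ []) × y ≡ 0))))
  spec inp (yes ψ-holds) = ≤-refl , λ y → mk⇔
    (λ { refl → ≤-refl , inj₁ (from (ψ-closed inp y) ψ-holds , sym (⟦weaken⟧ t inp [] y)) })
    (λ { (_ , inj₁ (_ , y≡t)) → sym (trans y≡t (⟦weaken⟧ t inp [] y))
       ; (_ , inj₂ (¬ψ , _))  → ⊥-elim (¬ψ (from (ψ-closed inp y) ψ-holds)) })
  spec inp (no ¬ψ-holds) = z≤n , λ y → mk⇔
    (λ { refl → z≤n , inj₂ ((λ ψy → ¬ψ-holds (to (ψ-closed inp 0) ψy)) , refl) })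
    (λ { (_ , inj₁ (ψy , _)) → ⊥-elim (¬ψ-holds (to (ψ-closed inp y) ψy))
       ; (_ , inj₂ (_ , y≡0)) → sym y≡0 })

-- Cantor pairing

tri-double : ∀ s → tri s + tri s ≡ s * suc s
tri-double zero    = refl
tri-double (suc s) = begin
  (suc s + tri s) + (suc s + tri s) ≡⟨ interchange (suc s) (tri s) ⟩
  (suc s + suc s) + (tri s + tri s) ≡⟨ cong ((suc s + suc s) +_) (tri-double s) ⟩
  (suc s + suc s) + s * suc s       ≡⟨ expand s ⟩
  suc s * suc (suc s)               ∎
  where
  open ≡-Reasoning
  interchange : ∀ a b → (a + b) + (a + b) ≡ (a + a) + (b + b)
  interchange = solve-∀
  expand : ∀ s → (suc s + suc s) + s * suc s ≡ suc s * suc (suc s)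
  expand = solve-∀

s≤tri : ∀ s → s ≤ tri s
s≤tri zero    = z≤n
s≤tri (suc s) = m≤m+n (suc s) (tri s)

tri-mono-≤ : ∀ {s t} → s ≤ t → tri s ≤ tri t
tri-mono-≤ {zero}  _         = z≤n
tri-mono-≤ {suc s} (s≤s s≤t) = +-mono-≤ (s≤s s≤t) (tri-mono-≤ s≤t)

tri≤s*s : ∀ s → tri s ≤ s * s
tri≤s*s zero    = z≤n
tri≤s*s (suc s) = begin
  suc s + tri s       ≤⟨ +-monoʳ-≤ (suc s) (≤-trans (tri≤s*s s) (m≤n+m (s * s) s)) ⟩
  suc s + (s + s * s) ≡⟨ cong (suc s +_) (sym (*-suc s s)) ⟩
  suc s * suc s       ∎
  where open ≤-Reasoning

x≤⟨x,y⟩ : ∀ x y → x ≤ ⟨ x , y ⟩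
x≤⟨x,y⟩ x y = ≤-trans (m≤m+n x y) (≤-trans (s≤tri (x + y)) (m≤m+n (tri (x + y)) y))

y≤⟨x,y⟩ : ∀ x y → y ≤ ⟨ x , y ⟩
y≤⟨x,y⟩ x y = m≤n+m y (tri (x + y))

tri≤⟨x,y⟩ : ∀ x y → tri (x + y) ≤ ⟨ x , y ⟩
tri≤⟨x,y⟩ x y = m≤m+n (tri (x + y)) y

⟨x,y⟩≤[x+y]²+y : ∀ x y → ⟨ x , y ⟩ ≤ (x + y) * (x + y) + y
⟨x,y⟩≤[x+y]²+y x y = +-monoˡ-≤ y (tri≤s*s (x + y))

⟨⟩-mono-≤ : ∀ {x x′ y y′} → x ≤ x′ → y ≤ y′ → ⟨ x , y ⟩ ≤ ⟨ x′ , y′ ⟩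
⟨⟩-mono-≤ x≤x′ y≤y′ = +-mono-≤ (tri-mono-≤ (+-mono-≤ x≤x′ y≤y′)) y≤y′

⟨x,y⟩<tri[1+x+y] : ∀ x y → ⟨ x , y ⟩ < tri (suc (x + y))
⟨x,y⟩<tri[1+x+y] x y = begin-strict
  tri (x + y) + y       ≤⟨ +-monoʳ-≤ (tri (x + y)) (m≤n+m y x) ⟩
  tri (x + y) + (x + y) <⟨ n<1+n _ ⟩
  suc (tri (x + y) + (x + y)) ≡⟨ cong suc (+-comm (tri (x + y)) (x + y)) ⟩
  tri (suc (x + y))     ∎
  where open ≤-Reasoning

-- The diagonal x + y is recovered from ⟨x,y⟩ since tri (x + y) ≤ ⟨x,y⟩ < tri (x + y + 1).
⟨⟩-injective-diagonal : ∀ x y x′ y′ → ⟨ x , y ⟩ ≡ ⟨ x′ , y′ ⟩ → x + y ≡ x′ + y′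
⟨⟩-injective-diagonal x y x′ y′ eq with <-cmp (x + y) (x′ + y′)
... | tri≈ _ s≡s′ _ = s≡s′
... | tri< s<s′ _ _ = ⊥-elim (<-irrefl eq
      (<-≤-trans (⟨x,y⟩<tri[1+x+y] x y) (≤-trans (tri-mono-≤ s<s′) (tri≤⟨x,y⟩ x′ y′))))
... | tri> _ _ s>s′ = ⊥-elim (<-irrefl (sym eq)
      (<-≤-trans (⟨x,y⟩<tri[1+x+y] x′ y′) (≤-trans (tri-mono-≤ s>s′) (tri≤⟨x,y⟩ x y))))

⟨⟩-injective : ∀ {x y x′ y′} → ⟨ x , y ⟩ ≡ ⟨ x′ , y′ ⟩ → x ≡ x′ × y ≡ y′
⟨⟩-injective {x} {y} {x′} {y′} eq = x≡x′ , y≡y′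
  where
  s≡s′ = ⟨⟩-injective-diagonal x y x′ y′ eq
  y≡y′ : y ≡ y′
  y≡y′ = +-cancelˡ-≡ (tri (x + y)) y y′ (trans eq (cong (λ s → tri s + y′) (sym s≡s′)))
  x≡x′ : x ≡ x′
  x≡x′ = +-cancelʳ-≡ y x x′ (trans s≡s′ (cong (x′ +_) (sym y≡y′)))

double-injective : ∀ a b → a + a ≡ b + b → a ≡ b
double-injective a b eq = trans (n≡⌊n+n/2⌋ a) (trans (cong ⌊_/2⌋ eq) (sym (n≡⌊n+n/2⌋ b)))

bit-index<length : ∀ S i → bit S i ≡ true → i < length S
bit-index<length (_ ∷ S) zero    _ = s≤s z≤n
bit-index<length (_ ∷ S) (suc i) b = s≤s (bit-index<length S i b)

triple-components≤ : ∀ {c a b t} → t ≡ ⟨ c , ⟨ a , b ⟩ ⟩ → c ≤ t × a ≤ t × b ≤ t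
triple-components≤ {c} {a} {b} refl =
  x≤⟨x,y⟩ c _ , ≤-trans (x≤⟨x,y⟩ a b) (y≤⟨x,y⟩ c _) , ≤-trans (y≤⟨x,y⟩ a b) (y≤⟨x,y⟩ c _)

triple-components≤length : ∀ S c a b → bit S ⟨ c , ⟨ a , b ⟩ ⟩ ≡ true →
  c ≤ length S × a ≤ length S × b ≤ length S
triple-components≤length S c a b t∈S =
  let (c≤t , a≤t , b≤t) = triple-components≤ refl
  in ≤-trans c≤t t≤|S| , ≤-trans a≤t t≤|S| , ≤-trans b≤t t≤|S|
  where t≤|S| = <⇒≤ (bit-index<length S _ t∈S)

-- Σ^B_0 definitions of pairing and of membership of a triple

-- With s = x + y, the equation z + z = s (s + 1) pins down z = tri s.
IsPair : Term k l v → Term k l v → Term k l v → Formula k l v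
IsPair p x y = ∃≤ p (∃≤ (weaken p)
  (((var #0 ⊕ var #0) ≡f (var #1 ⊗ (var #1 ⊕ one))) ∧f
   ((var #1 ≡f (weaken (weaken x) ⊕ weaken (weaken y))) ∧f
    (weaken (weaken p) ≡f (var #0 ⊕ weaken (weaken y))))))

IsPair-sem : ∀ (p x y : Term k l v) inp ρ →
  ⟦ IsPair p x y ⟧F inp ρ ⇔ (⟦ p ⟧T inp ρ ≡ ⟨ ⟦ x ⟧T inp ρ , ⟦ y ⟧T inp ρ ⟩)
IsPair-sem {k = k} {l = l} {v = v} p x y inp ρ = mk⇔ sound complete
  where
  X = ⟦ x ⟧T inp ρ
  Y = ⟦ y ⟧T inp ρ
  ⟦_⟧² : Term k l v → ℕ → ℕ → ℕ
  ⟦ t ⟧² z s = ⟦ weaken (weaken t) ⟧T inp (z ∷ s ∷ ρ)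
  sound : ⟦ IsPair p x y ⟧F inp ρ → ⟦ p ⟧T inp ρ ≡ ⟨ X , Y ⟩
  sound (s , _ , z , _ , z+z≡s[s+1] , s≡x+y , p≡z+y) = begin
    ⟦ p ⟧T inp ρ           ≡⟨ sym (⟦weaken²⟧ p inp ρ z s) ⟩
    ⟦ p ⟧² z s             ≡⟨ p≡z+y ⟩
    z + ⟦ y ⟧² z s         ≡⟨ cong₂ _+_ z≡tri[x+y] (⟦weaken²⟧ y inp ρ z s) ⟩
    ⟨ X , Y ⟩              ∎
    where
    open ≡-Reasoning
    s≡X+Y : s ≡ X + Y
    s≡X+Y = trans s≡x+y (cong₂ _+_ (⟦weaken²⟧ x inp ρ z s) (⟦weaken²⟧ y inp ρ z s))
    z≡tri[x+y] : z ≡ tri (X + Y)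
    z≡tri[x+y] = trans
      (double-injective z (tri s) (trans z+z≡s[s+1] (trans (cong (s *_) (+-comm s 1)) (sym (tri-double s)))))
      (cong tri s≡X+Y)
  complete : ⟦ p ⟧T inp ρ ≡ ⟨ X , Y ⟩ → ⟦ IsPair p x y ⟧F inp ρ
  complete p≡⟨x,y⟩ = s , s≤p , tri s , tri≤p , z+z≡s[s+1] , s≡x+y , p≡z+y
    where
    s = X + Y
    s≤p : s ≤ ⟦ p ⟧T inp ρ
    s≤p = ≤-trans (s≤tri s) (≤-trans (tri≤⟨x,y⟩ X Y) (≤-reflexive (sym p≡⟨x,y⟩)))
    tri≤p : tri s ≤ ⟦ weaken p ⟧T inp (s ∷ ρ)
    tri≤p = ≤-trans (tri≤⟨x,y⟩ X Y) (≤-reflexive (sym (trans (⟦weaken⟧ p inp ρ s) p≡⟨x,y⟩)))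
    z+z≡s[s+1] : tri s + tri s ≡ s * (s + 1)
    z+z≡s[s+1] = trans (tri-double s) (cong (s *_) (+-comm 1 s))
    s≡x+y : s ≡ ⟦ x ⟧² (tri s) s + ⟦ y ⟧² (tri s) s
    s≡x+y = sym (cong₂ _+_ (⟦weaken²⟧ x inp ρ (tri s) s) (⟦weaken²⟧ y inp ρ (tri s) s))
    p≡z+y : ⟦ p ⟧² (tri s) s ≡ tri s + ⟦ y ⟧² (tri s) s
    p≡z+y = trans (⟦weaken²⟧ p inp ρ (tri s) s)
                  (trans p≡⟨x,y⟩ (cong (tri s +_) (sym (⟦weaken²⟧ y inp ρ (tri s) s))))

IsTriple : Term k l v → Term k l v → Term k l v → Term k l v → Formula k l v
IsTriple p c a b = ∃≤ p (IsPair (var #0) (weaken a) (weaken b) ∧f IsPair (weaken p) (weaken c) (var #0))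

IsTriple-sem : ∀ (p c a b : Term k l v) inp ρ →
  ⟦ IsTriple p c a b ⟧F inp ρ ⇔
  (⟦ p ⟧T inp ρ ≡ ⟨ ⟦ c ⟧T inp ρ , ⟨ ⟦ a ⟧T inp ρ , ⟦ b ⟧T inp ρ ⟩ ⟩)
IsTriple-sem p c a b inp ρ = mk⇔ sound complete
  where
  triple = ⟨ ⟦ c ⟧T inp ρ , ⟨ ⟦ a ⟧T inp ρ , ⟦ b ⟧T inp ρ ⟩ ⟩
  ⟦_⟧′ : ∀ t q → ⟦ weaken t ⟧T inp (q ∷ ρ) ≡ ⟦ t ⟧T inp ρ
  ⟦ t ⟧′ q = ⟦weaken⟧ t inp ρ q
  sound : ⟦ IsTriple p c a b ⟧F inp ρ → ⟦ p ⟧T inp ρ ≡ triple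
  sound (q , _ , q-pair , p-pair) = begin
    ⟦ p ⟧T inp ρ                     ≡⟨ sym (⟦ p ⟧′ q) ⟩
    ⟦ weaken p ⟧T inp (q ∷ ρ)        ≡⟨ to (IsPair-sem (weaken p) (weaken c) (var #0) inp (q ∷ ρ)) p-pair ⟩
    ⟨ ⟦ weaken c ⟧T inp (q ∷ ρ) , q ⟩ ≡⟨ cong₂ ⟨_,_⟩ (⟦ c ⟧′ q) q≡⟨a,b⟩ ⟩
    triple                           ∎
    where
    open ≡-Reasoning
    q≡⟨a,b⟩ = trans (to (IsPair-sem (var #0) (weaken a) (weaken b) inp (q ∷ ρ)) q-pair)
                    (cong₂ ⟨_,_⟩ (⟦ a ⟧′ q) (⟦ b ⟧′ q))
  complete : ⟦ p ⟧T inp ρ ≡ triple → ⟦ IsTriple p c a b ⟧F inp ρ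
  complete p≡ = q , q≤p
    , from (IsPair-sem (var #0) (weaken a) (weaken b) inp (q ∷ ρ)) (sym (cong₂ ⟨_,_⟩ (⟦ a ⟧′ q) (⟦ b ⟧′ q)))
    , from (IsPair-sem (weaken p) (weaken c) (var #0) inp (q ∷ ρ))
           (trans (⟦ p ⟧′ q) (trans p≡ (cong ⟨_, q ⟩ (sym (⟦ c ⟧′ q)))))
    where
    q = ⟨ ⟦ a ⟧T inp ρ , ⟦ b ⟧T inp ρ ⟩
    q≤p = ≤-trans (y≤⟨x,y⟩ (⟦ c ⟧T inp ρ) q) (≤-reflexive (sym p≡))

HasTriple : Fin l → Term k l v → Term k l v → Term k l v → Formula k l v
HasTriple j c a b = ∃≤ (len j) (IsTriple (var #0) (weaken c) (weaken a) (weaken b) ∧f mem j (var #0))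

HasTriple-sem : ∀ j (c a b : Term k l v) inp ρ →
  ⟦ HasTriple j c a b ⟧F inp ρ ⇔
  (bit (lookup (proj₂ inp) j) ⟨ ⟦ c ⟧T inp ρ , ⟨ ⟦ a ⟧T inp ρ , ⟦ b ⟧T inp ρ ⟩ ⟩ ≡ true)
HasTriple-sem j c a b inp ρ = mk⇔
  (λ (p , _ , p-triple , p∈S) → subst (λ z → bit S z ≡ true) (p≡triple p p-triple) p∈S)
  (λ t∈S → _ , <⇒≤ (bit-index<length S _ t∈S)
              , from (IsTriple-sem (var #0) (weaken c) (weaken a) (weaken b) inp (_ ∷ ρ)) (sym (wk-triple _)) , t∈S)
  where
  S = lookup (proj₂ inp) j
  wk-triple : ∀ p →
    ⟨ ⟦ weaken c ⟧T inp (p ∷ ρ) , ⟨ ⟦ weaken a ⟧T inp (p ∷ ρ) , ⟦ weaken b ⟧T inp (p ∷ ρ) ⟩ ⟩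
    ≡ ⟨ ⟦ c ⟧T inp ρ , ⟨ ⟦ a ⟧T inp ρ , ⟦ b ⟧T inp ρ ⟩ ⟩
  wk-triple p = cong₂ ⟨_,_⟩ (⟦weaken⟧ c inp ρ p) (cong₂ ⟨_,_⟩ (⟦weaken⟧ a inp ρ p) (⟦weaken⟧ b inp ρ p))
  p≡triple : ∀ p → ⟦ IsTriple (var #0) (weaken c) (weaken a) (weaken b) ⟧F inp (p ∷ ρ) → p ≡ _
  p≡triple p t = trans (to (IsTriple-sem (var #0) (weaken c) (weaken a) (weaken b) inp (p ∷ ρ)) t) (wk-triple p)

module _ {A : Set} where

  nth : List A → ℕ → Maybe A
  nth []       _       = nothing
  nth (x ∷ xs) zero    = just x
  nth (x ∷ xs) (suc k) = nth xs k

  nth-lookup : ∀ xs (i : Fin (length xs)) → nth xs (toℕ i) ≡ just (List.lookup xs i)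
  nth-lookup (x ∷ xs) Fin.zero    = refl
  nth-lookup (x ∷ xs) (Fin.suc i) = nth-lookup xs i

  nth⇒lookup : ∀ xs k {x} → nth xs k ≡ just x → Σ (Fin (length xs)) λ i → toℕ i ≡ k × List.lookup xs i ≡ x
  nth⇒lookup (y ∷ xs) zero    refl = Fin.zero , refl , refl
  nth⇒lookup (y ∷ xs) (suc k) eq   =
    let (i , i≡k , xsᵢ≡x) = nth⇒lookup xs k eq in Fin.suc i , cong suc i≡k , xsᵢ≡x

  nth⇒< : ∀ xs k {x} → nth xs k ≡ just x → k < length xs
  nth⇒< (y ∷ xs) zero    _  = s≤s z≤n
  nth⇒< (y ∷ xs) (suc k) eq = s≤s (nth⇒< xs k eq)

  <⇒nth : ∀ xs k → k < length xs → Σ A λ x → nth xs k ≡ just x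
  <⇒nth (y ∷ xs) zero    _         = y , refl
  <⇒nth (y ∷ xs) (suc k) (s≤s k<n) = <⇒nth xs k k<n

  All-nth : ∀ {P : A → Set} xs k {x} → All P xs → nth xs k ≡ just x → P x
  All-nth (y ∷ xs) zero    (py ∷ _)   refl = py
  All-nth (y ∷ xs) (suc k) (_  ∷ pxs) eq   = All-nth xs k pxs eq

  nth-extensionality : ∀ xs ys → length xs ≡ length ys →
    (∀ k {x y} → nth xs k ≡ just x → nth ys k ≡ just y → x ≡ y) → xs ≡ ys
  nth-extensionality []       []       _   _  = refl
  nth-extensionality (x ∷ xs) (y ∷ ys) |xs|≡|ys| eq =
    cong₂ _∷_ (eq zero refl refl) (nth-extensionality xs ys (suc-injective |xs|≡|ys|) (λ k → eq (suc k)))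

  tabulate< : ∀ c → ((k : ℕ) → k < c → A) → List A
  tabulate< zero    g = []
  tabulate< (suc c) g = g 0 (s≤s z≤n) ∷ tabulate< c (λ k k<c → g (suc k) (s≤s k<c))

  length-tabulate< : ∀ c g → length (tabulate< c g) ≡ c
  length-tabulate< zero    g = refl
  length-tabulate< (suc c) g = cong suc (length-tabulate< c _)

  nth-tabulate< : ∀ c g k {x} → nth (tabulate< c g) k ≡ just x → Σ (k < c) λ k<c → g k k<c ≡ x
  nth-tabulate< (suc c) g zero    refl = s≤s z≤n , refl
  nth-tabulate< (suc c) g (suc k) eq   =
    let (k<c , gk≡x) = nth-tabulate< c (λ k k<c → g (suc k) (s≤s k<c)) k eq in s≤s k<c , gk≡x

  All-tabulate< : ∀ {P : A → Set} c g → (∀ k k<c → P (g k k<c)) → All P (tabulate< c g)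
  All-tabulate< zero    g pg = []
  All-tabulate< (suc c) g pg = pg 0 (s≤s z≤n) ∷ All-tabulate< c _ (λ k k<c → pg (suc k) (s≤s k<c))

module _ {A B : Set} (f : A → B) where

  nth-map⁺ : ∀ xs k {x} → nth xs k ≡ just x → nth (map f xs) k ≡ just (f x)
  nth-map⁺ (y ∷ xs) zero    refl = refl
  nth-map⁺ (y ∷ xs) (suc k) eq   = nth-map⁺ xs k eq

  nth-map⁻ : ∀ xs k {y} → nth (map f xs) k ≡ just y → Σ A λ x → nth xs k ≡ just x × f x ≡ y
  nth-map⁻ (x ∷ xs) zero    refl = x , refl , refl
  nth-map⁻ (x ∷ xs) (suc k) eq   = nth-map⁻ xs k eq

-- Comparator networks on ℕ-indexed wires

Network : Set
Network = List (ℕ × ℕ)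

comparator : ℕ × ℕ → (ℕ → Bool) → (ℕ → Bool)
comparator (a , b) f i with i ≟ a
... | yes _ = f a ∧ f b
... | no  _ with i ≟ b
...   | yes _ = f a ∨ f b
...   | no  _ = f i

evaluate : Network → (ℕ → Bool) → (ℕ → Bool)
evaluate []       f = f
evaluate (g ∷ gs) f = evaluate gs (comparator g f)

evaluate-++ : ∀ gs hs f → evaluate (gs ++ hs) f ≡ evaluate hs (evaluate gs f)
evaluate-++ []       hs f = refl
evaluate-++ (g ∷ gs) hs f = evaluate-++ gs hs (comparator g f)

comparator-min : ∀ a b f → comparator (a , b) f a ≡ (f a ∧ f b)
comparator-min a b f with a ≟ a
... | yes _  = refl
... | no a≢a = ⊥-elim (a≢a refl)

comparator-max : ∀ a b f → a ≢ b → comparator (a , b) f b ≡ (f a ∨ f b)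
comparator-max a b f a≢b with b ≟ a
... | yes b≡a = ⊥-elim (a≢b (sym b≡a))
... | no  _ with b ≟ b
...   | yes _  = refl
...   | no b≢b = ⊥-elim (b≢b refl)

comparator-other : ∀ a b f i → i ≢ a → i ≢ b → comparator (a , b) f i ≡ f i
comparator-other a b f i i≢a i≢b with i ≟ a
... | yes i≡a = ⊥-elim (i≢a i≡a)
... | no  _ with i ≟ b
...   | yes i≡b = ⊥-elim (i≢b i≡b)
...   | no  _   = refl

endpoints : ∀ {m} → Gate m → ℕ × ℕ
endpoints g = toℕ (minW g) , toℕ (maxW g)

network : ∀ {m} → List (Gate m) → Network
network = map endpoints

applyGate≗comparator : ∀ {m} (g : Gate m) v f → (∀ w → v w ≡ f (toℕ w)) →
  ∀ w → applyGate g v w ≡ comparator (endpoints g) f (toℕ w)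
applyGate≗comparator g v f v≗f w with w Fin.≟ minW g | toℕ w ≟ toℕ (minW g)
... | yes _   | yes _   = cong₂ _∧_ (v≗f (minW g)) (v≗f (maxW g))
... | yes w≡a | no  w≢a = ⊥-elim (w≢a (cong toℕ w≡a))
... | no  w≢a | yes w≡a = ⊥-elim (w≢a (toℕ-injective w≡a))
... | no  _   | no  _ with w Fin.≟ maxW g | toℕ w ≟ toℕ (maxW g)
...   | yes _   | yes _   = cong₂ _∨_ (v≗f (minW g)) (v≗f (maxW g))
...   | yes w≡b | no  w≢b = ⊥-elim (w≢b (cong toℕ w≡b))
...   | no  w≢b | yes w≡b = ⊥-elim (w≢b (toℕ-injective w≡b))
...   | no  _   | no  _   = v≗f w

run≗evaluate : ∀ {m} (gs : List (Gate m)) v f → (∀ w → v w ≡ f (toℕ w)) →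
  ∀ w → run gs v w ≡ evaluate (network gs) f (toℕ w)
run≗evaluate []       v f v≗f = v≗f
run≗evaluate (g ∷ gs) v f v≗f =
  run≗evaluate gs (applyGate g v) (comparator (endpoints g) f) (applyGate≗comparator g v f v≗f)

run≡evaluate-network : ∀ {m} (gs : List (Gate m)) I {d} (d<m : d < m) →
  run gs (λ w → bit I (toℕ w)) (fromℕ< d<m) ≡ evaluate (network gs) (bit I) d
run≡evaluate-network gs I d<m =
  trans (run≗evaluate gs _ (bit I) (λ _ → refl) (fromℕ< d<m))
        (cong (evaluate (network gs) (bit I)) (toℕ-fromℕ< d<m))

ValidPair : ℕ → ℕ × ℕ → Set
ValidPair m (a , b) = a < m × b < m × a ≢ b

network-valid : ∀ {m} (gs : List (Gate m)) → All (ValidPair m) (network gs)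
network-valid []       = []
network-valid (g ∷ gs) =
  (toℕ<n (minW g) , toℕ<n (maxW g) , λ eq → distinct g (toℕ-injective eq)) ∷ network-valid gs

gates : ∀ {m} (ps : Network) → All (ValidPair m) ps → List (Gate m)
gates []             []                           = []
gates ((a , b) ∷ ps) ((a<m , b<m , a≢b) ∷ valid) =
  gate (fromℕ< a<m) (fromℕ< b<m) fromℕ<a≢fromℕ<b ∷ gates ps valid
  where
  fromℕ<a≢fromℕ<b : fromℕ< a<m ≢ fromℕ< b<m
  fromℕ<a≢fromℕ<b eq = a≢b (trans (sym (toℕ-fromℕ< a<m)) (trans (cong toℕ eq) (toℕ-fromℕ< b<m)))

network-gates : ∀ {m} ps (valid : All (ValidPair m) ps) → network (gates ps valid) ≡ ps
network-gates []             []            = refl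
network-gates ((a , b) ∷ ps) ((a<m , b<m , _) ∷ valid) =
  cong₂ _∷_ (cong₂ _,_ (toℕ-fromℕ< a<m) (toℕ-fromℕ< b<m)) (network-gates ps valid)

length-gates : ∀ {m} ps (valid : All (ValidPair m) ps) → length (gates ps valid) ≡ length ps
length-gates ps valid = trans (sym (length-map endpoints (gates ps valid))) (cong length (network-gates ps valid))

Encodes : Str → Network → Set
Encodes S ps = ∀ k {p} → nth ps k ≡ just p → ∀ a b → (bit S ⟨ k , ⟨ a , b ⟩ ⟩ ≡ true) ⇔ (p ≡ (a , b))

GatesEncoded⇒Encodes : ∀ {m} S (gs : List (Gate m)) → GatesEncoded S gs → Encodes S (network gs)
GatesEncoded⇒Encodes S gs enc k eq a b with nth-map⁻ endpoints gs k eq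
... | g , nthₖ≡g , refl with nth⇒lookup gs k nthₖ≡g
...   | i , refl , refl =
  mk⇔ (λ b∈S → ×-≡,≡→≡ (to (enc i a b) b∈S)) (λ eq → from (enc i a b) (×-≡,≡←≡ eq))

Encodes⇒GatesEncoded : ∀ {m} S (gs : List (Gate m)) → Encodes S (network gs) → GatesEncoded S gs
Encodes⇒GatesEncoded S gs enc i a b =
  mk⇔ (λ b∈S → ×-≡,≡←≡ (to (enc′ a b) b∈S)) (λ eq → from (enc′ a b) (×-≡,≡→≡ eq))
  where enc′ = enc (toℕ i) (nth-map⁺ endpoints gs (toℕ i) (nth-lookup gs i))

gates-encoded : ∀ {m} S ps (valid : All (ValidPair m) ps) → Encodes S ps → GatesEncoded S (gates ps valid)
gates-encoded S ps valid enc =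
  Encodes⇒GatesEncoded S (gates ps valid) (subst (Encodes S) (sym (network-gates ps valid)) enc)

Encodes-unique : ∀ S ps qs → Encodes S ps → Encodes S qs → length ps ≡ length qs → ps ≡ qs
Encodes-unique S ps qs enc-ps enc-qs |ps|≡|qs| = nth-extensionality ps qs |ps|≡|qs|
  λ k {p} {q} nthₖ≡p nthₖ≡q →
    to (enc-ps k nthₖ≡p (proj₁ q) (proj₂ q)) (from (enc-qs k nthₖ≡q (proj₁ q) (proj₂ q)) refl)

data Direction : Set where
  down up : Direction

opposite : Direction → Direction
opposite down = up
opposite up   = down

Points : Direction → ∀ {m} → Gate m → Set
Points down = PointsDown
Points up   = PointsUp

Oriented : Direction → ℕ × ℕ → Set
Oriented down (a , b) = a < b
Oriented up   (a , b) = b < a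

gates-points : ∀ dir {m} ps (valid : All (ValidPair m) ps) → All (Oriented dir) ps →
  All (Points dir) (gates ps valid)
gates-points dir []             []                      []         = []
gates-points dir ((a , b) ∷ ps) ((a<m , b<m , _) ∷ valid) (o ∷ os) = points dir o ∷ gates-points dir ps valid os
  where
  points : ∀ dir → Oriented dir (a , b) → Points dir (gate (fromℕ< a<m) (fromℕ< b<m) _)
  points down a<b = subst₂ _<_ (sym (toℕ-fromℕ< a<m)) (sym (toℕ-fromℕ< b<m)) a<b
  points up   b<a = subst₂ _<_ (sym (toℕ-fromℕ< b<m)) (sym (toℕ-fromℕ< a<m)) b<a

-- With O holding 1 and Z holding 0: B is parked on Z (leaving 0 on B), A is compared
-- with Z, O sets B to 1, and B is compared with Z.

gadgetStep : {X : Set} → X → X → X → X → Fin 4 → X × X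
gadgetStep A B O Z 0F = B , Z
gadgetStep A B O Z 1F = A , Z
gadgetStep A B O Z 2F = O , B
gadgetStep A B O Z 3F = B , Z

gadget : ℕ → ℕ → ℕ → ℕ → Network
gadget A B O Z = List.tabulate (gadgetStep A B O Z)

record Distinct₄ (A B O Z : ℕ) : Set where
  field
    A≢B : A ≢ B
    A≢O : A ≢ O
    A≢Z : A ≢ Z
    B≢O : B ≢ O
    B≢Z : B ≢ Z
    O≢Z : O ≢ Z

module _ {A B O Z : ℕ} (distinct₄ : Distinct₄ A B O Z)
         (f : ℕ → Bool) (fO≡1 : f O ≡ true) (fZ≡0 : f Z ≡ false) where
  open Distinct₄ distinct₄

  private
    f₁ f₂ f₃ : ℕ → Bool
    f₁ = comparator (B , Z) f
    f₂ = comparator (A , Z) f₁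
    f₃ = comparator (O , B) f₂

    f₂A : f₂ A ≡ f A ∧ f B
    f₂A = trans (comparator-min A Z f₁)
                (cong₂ _∧_ (comparator-other B Z f A A≢B A≢Z)
                           (trans (comparator-max B Z f B≢Z) (trans (cong (f B ∨_) fZ≡0) (∨-identityʳ (f B)))))

    f₂Z : f₂ Z ≡ f A ∨ f B
    f₂Z = trans (comparator-max A Z f₁ A≢Z)
                (cong₂ _∨_ (comparator-other B Z f A A≢B A≢Z)
                           (trans (comparator-max B Z f B≢Z) (trans (cong (f B ∨_) fZ≡0) (∨-identityʳ (f B)))))

    f₃B : f₃ B ≡ true
    f₃B = trans (comparator-max O B f₂ (λ O≡B → B≢O (sym O≡B)))
                (cong₂ _∨_ (trans (comparator-other A Z f₁ O (λ O≡A → A≢O (sym O≡A)) O≢Z)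
                                  (trans (comparator-other B Z f O (λ O≡B → B≢O (sym O≡B)) O≢Z) fO≡1))
                           refl)

  gadget-min : evaluate (gadget A B O Z) f A ≡ f A ∧ f B
  gadget-min = trans (comparator-other B Z f₃ A A≢B A≢Z)
                     (trans (comparator-other O B f₂ A A≢O A≢B) f₂A)

  gadget-max : evaluate (gadget A B O Z) f B ≡ f A ∨ f B
  gadget-max = trans (comparator-min B Z f₃) (trans (cong₂ _∧_ f₃B f₃Z) (∧-identityˡ _))
    where
    f₃Z : f₃ Z ≡ f A ∨ f B
    f₃Z = trans (comparator-other O B f₂ Z (λ Z≡O → O≢Z (sym Z≡O)) (λ Z≡B → B≢Z (sym Z≡B))) f₂Z

  gadget-other : ∀ i → i ≢ A → i ≢ B → i ≢ O → i ≢ Z → evaluate (gadget A B O Z) f i ≡ f i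
  gadget-other i i≢A i≢B i≢O i≢Z =
    trans (comparator-other B Z f₃ i i≢B i≢Z)
    (trans (comparator-other O B f₂ i i≢O i≢B)
    (trans (comparator-other A Z f₁ i i≢A i≢Z)
           (comparator-other B Z f i i≢B i≢Z)))

j*4+r-injective : ∀ j j′ (r r′ : Fin 4) → j * 4 + toℕ r ≡ j′ * 4 + toℕ r′ → j ≡ j′ × r ≡ r′
j*4+r-injective zero     zero     r r′ eq = refl , toℕ-injective eq
j*4+r-injective zero     (suc j′) r r′ eq = ⊥-elim (<⇒≢ (<-≤-trans (toℕ<n r) (m≤m+n 4 _)) eq)
j*4+r-injective (suc j)  zero     r r′ eq = ⊥-elim (<⇒≢ (<-≤-trans (toℕ<n r′) (m≤m+n 4 _)) (sym eq))
j*4+r-injective (suc j)  (suc j′) r r′ eq =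
  let (j≡j′ , r≡r′) = j*4+r-injective j j′ r r′ (suc-injective (suc-injective (suc-injective (suc-injective eq))))
  in cong suc j≡j′ , r≡r′

j*4+r<n*4 : ∀ {j n} (r : Fin 4) → j < n → j * 4 + toℕ r < n * 4
j*4+r<n*4 {j} {n} r j<n = begin-strict
  j * 4 + toℕ r ≤⟨ +-monoʳ-≤ (j * 4) (toℕ≤pred[n] r) ⟩
  j * 4 + 3     <⟨ +-monoʳ-< (j * 4) (n<1+n 3) ⟩
  j * 4 + 4     ≡⟨ +-comm (j * 4) 4 ⟩
  suc j * 4     ≤⟨ *-monoˡ-≤ 4 j<n ⟩
  n * 4         ∎
  where open ≤-Reasoning

-- Wires n + w (w < m) carry the simulated circuit; the j-th gate gets the wire j above
-- them and the wire n + m + j below them as its O and Z wires, in an order fixed by the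
-- direction.
module Layout (m n : ℕ) where

  main : ℕ → ℕ
  main w = n + w

  side : Direction → ℕ → ℕ
  side down j = j
  side up   j = n + m + j

  width : ℕ
  width = n + m + n

  main-injective : ∀ {w w′} → main w ≡ main w′ → w ≡ w′
  main-injective = +-cancelˡ-≡ n _ _

  j≤side : ∀ dir j → j ≤ side dir j
  j≤side down j = ≤-refl
  j≤side up   j = m≤n+m j (n + m)

  side-injective : ∀ dir {j j′} → side dir j ≡ side dir j′ → j ≡ j′
  side-injective down = id
  side-injective up   = +-cancelˡ-≡ (n + m) _ _

  low<main : ∀ {j w} → j < n → side down j < main w
  low<main {j} {w} j<n = <-≤-trans j<n (m≤m+n n w)

  main<high : ∀ {j w} → w < m → main w < side up j
  main<high {j} {w} w<m =
    <-≤-trans (+-monoʳ-< n (<-≤-trans w<m (m≤m+n m j))) (≤-reflexive (sym (+-assoc n m j)))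

  side≢main : ∀ dir {j w} → j < n → w < m → side dir j ≢ main w
  side≢main down j<n _   = <⇒≢ (low<main j<n)
  side≢main up   _   w<m = >⇒≢ (main<high w<m)

  side≢opposite : ∀ dir {j j′} → j < n → j′ < n → side dir j ≢ side (opposite dir) j′
  side≢opposite down {j} {j′} j<n _ eq = <-irrefl eq (<-≤-trans j<n (≤-trans (m≤m+n n m) (m≤m+n (n + m) j′)))
  side≢opposite up   {j} {j′} _ j′<n eq = <-irrefl (sym eq) (<-≤-trans j′<n (≤-trans (m≤m+n n m) (m≤m+n (n + m) j)))

  main<width : ∀ {w} → w < m → main w < width
  main<width {w} w<m = <-≤-trans (+-monoʳ-< n w<m) (m≤m+n (n + m) n)

  side<width : ∀ dir {j} → j < n → side dir j < width
  side<width down {j} j<n = <-≤-trans j<n (m≤n+m n (n + m))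
  side<width up   {j} j<n = +-monoʳ-< (n + m) j<n

  module Expansion (dir : Direction) where

    oneWire zeroWire : ℕ → ℕ
    oneWire  = side dir
    zeroWire = side (opposite dir)

    blockStep : ℕ → ℕ × ℕ → Fin 4 → ℕ × ℕ
    blockStep j (a , b) = gadgetStep (main a) (main b) (oneWire j) (zeroWire j)

    block : ℕ → ℕ × ℕ → Network
    block j (a , b) = gadget (main a) (main b) (oneWire j) (zeroWire j)

    expand : ℕ → Network → Network
    expand j []       = []
    expand j (p ∷ ps) = block j p ++ expand (suc j) ps

    blockStep-oriented : ∀ {j} a b r → j < n → a < m → b < m → Oriented dir (blockStep j (a , b) r)
    blockStep-oriented {j} a b r j<n a<m b<m = oriented dir r
      where
      oriented : ∀ dir r → Oriented dir (gadgetStep (main a) (main b) (side dir j) (side (opposite dir) j) r)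
      oriented down 0F = main<high b<m
      oriented down 1F = main<high a<m
      oriented down 2F = low<main j<n
      oriented down 3F = main<high b<m
      oriented up   0F = low<main j<n
      oriented up   1F = low<main j<n
      oriented up   2F = main<high b<m
      oriented up   3F = low<main j<n

    blockStep-valid : ∀ {j} a b r → j < n → a < m → b < m → ValidPair width (blockStep j (a , b) r)
    blockStep-valid {j} a b r j<n a<m b<m =
      proj₁ (in-range r) , proj₂ (in-range r) , oriented⇒≢ dir (blockStep-oriented a b r j<n a<m b<m)
      where
      oriented⇒≢ : ∀ dir {p q} → Oriented dir (p , q) → p ≢ q
      oriented⇒≢ down = <⇒≢
      oriented⇒≢ up   = >⇒≢
      in-range : ∀ r → proj₁ (blockStep j (a , b) r) < width × proj₂ (blockStep j (a , b) r) < width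
      in-range 0F = main<width b<m , side<width (opposite dir) j<n
      in-range 1F = main<width a<m , side<width (opposite dir) j<n
      in-range 2F = side<width dir j<n , main<width b<m
      in-range 3F = main<width b<m , side<width (opposite dir) j<n

    Simulates : ℕ → (ℕ → Bool) → (ℕ → Bool) → Set
    Simulates k f′ f = (∀ w → w < m → f′ (main w) ≡ f w) ×
                       (∀ j → k ≤ j → j < n → f′ (oneWire j) ≡ true × f′ (zeroWire j) ≡ false)

    block-simulates : ∀ k a b f′ f → k < n → ValidPair m (a , b) → Simulates k f′ f →
      Simulates (suc k) (evaluate (block k (a , b)) f′) (comparator (a , b) f)
    block-simulates k a b f′ f k<n (a<m , b<m , a≢b) (f′≗f , constants) = mains , constants′
      where
      O≢main : ∀ {w} → w < m → oneWire k ≢ main w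
      O≢main = side≢main dir k<n
      Z≢main : ∀ {w} → w < m → zeroWire k ≢ main w
      Z≢main = side≢main (opposite dir) k<n
      distinct₄ : Distinct₄ (main a) (main b) (oneWire k) (zeroWire k)
      distinct₄ = record
        { A≢B = λ eq → a≢b (main-injective eq)
        ; A≢O = λ eq → O≢main a<m (sym eq)
        ; A≢Z = λ eq → Z≢main a<m (sym eq)
        ; B≢O = λ eq → O≢main b<m (sym eq)
        ; B≢Z = λ eq → Z≢main b<m (sym eq)
        ; O≢Z = side≢opposite dir k<n k<n
        }
      O≡1 = proj₁ (constants k ≤-refl k<n)
      Z≡0 = proj₂ (constants k ≤-refl k<n)
      unchanged : ∀ i → i ≢ main a → i ≢ main b → i ≢ oneWire k → i ≢ zeroWire k →
        evaluate (block k (a , b)) f′ i ≡ f′ i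
      unchanged = gadget-other distinct₄ f′ O≡1 Z≡0

      mains : ∀ w → w < m → evaluate (block k (a , b)) f′ (main w) ≡ comparator (a , b) f w
      mains w w<m = byCases (w ≟ a) (w ≟ b)
        where
        byCases : Dec (w ≡ a) → Dec (w ≡ b) → evaluate (block k (a , b)) f′ (main w) ≡ comparator (a , b) f w
        byCases (yes refl) _ = trans (gadget-min distinct₄ f′ O≡1 Z≡0)
          (trans (cong₂ _∧_ (f′≗f a a<m) (f′≗f b b<m)) (sym (comparator-min a b f)))
        byCases (no _) (yes refl) = trans (gadget-max distinct₄ f′ O≡1 Z≡0)
          (trans (cong₂ _∨_ (f′≗f a a<m) (f′≗f b b<m)) (sym (comparator-max a b f a≢b)))
        byCases (no w≢a) (no w≢b) =
          trans (unchanged (main w) (λ eq → w≢a (main-injective eq)) (λ eq → w≢b (main-injective eq))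
                           (λ eq → O≢main w<m (sym eq)) (λ eq → Z≢main w<m (sym eq)))
                (trans (f′≗f w w<m) (sym (comparator-other a b f w w≢a w≢b)))

      constants′ : ∀ j → suc k ≤ j → j < n →
        evaluate (block k (a , b)) f′ (oneWire j) ≡ true × evaluate (block k (a , b)) f′ (zeroWire j) ≡ false
      constants′ j k<j j<n =
        trans (unchanged (oneWire j) (side≢main dir j<n a<m) (side≢main dir j<n b<m)
                         (λ eq → <⇒≢ k<j (sym (side-injective dir eq))) (side≢opposite dir j<n k<n))
              (proj₁ (constants j (<⇒≤ k<j) j<n)) ,
        trans (unchanged (zeroWire j) (side≢main (opposite dir) j<n a<m) (side≢main (opposite dir) j<n b<m)
                         (λ eq → side≢opposite dir k<n j<n (sym eq))
                         (λ eq → <⇒≢ k<j (sym (side-injective (opposite dir) eq))))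
              (proj₂ (constants j (<⇒≤ k<j) j<n))

    expand-simulates : ∀ ps k f′ f → k + length ps ≤ n → All (ValidPair m) ps → Simulates k f′ f →
      Simulates (k + length ps) (evaluate (expand k ps) f′) (evaluate ps f)
    expand-simulates []             k f′ f _ _ sim = subst (λ k → Simulates k f′ f) (sym (+-identityʳ k)) sim
    expand-simulates ((a , b) ∷ ps) k f′ f k+|ps|<n (valid ∷ valids) sim =
      subst₂ (λ k g → Simulates k g (evaluate ps (comparator (a , b) f)))
        (sym (+-suc k (length ps)))
        (sym (evaluate-++ (block k (a , b)) (expand (suc k) ps) f′))
        (expand-simulates ps (suc k) _ _ (≤-trans (≤-reflexive (sym (+-suc k (length ps)))) k+|ps|<n) valids
          (block-simulates k a b f′ f (<-≤-trans (m<m+n k (s≤s z≤n)) k+|ps|<n) valid sim))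


    length-expand : ∀ k ps → length (expand k ps) ≡ length ps * 4
    length-expand k []       = refl
    length-expand k (p ∷ ps) = cong (λ l → suc (suc (suc (suc l)))) (length-expand (suc k) ps)

    nth-expand⁻ : ∀ k ps k′ {p′} → nth (expand k ps) k′ ≡ just p′ →
      Σ ℕ λ j → Σ (Fin 4) λ r → Σ (ℕ × ℕ) λ p →
        k′ ≡ j * 4 + toℕ r × nth ps j ≡ just p × p′ ≡ blockStep (k + j) p r
    nth-expand⁻ k (p ∷ ps) 0 refl = 0 , 0F , p , refl , refl , cong (λ k → blockStep k p 0F) (sym (+-identityʳ k))
    nth-expand⁻ k (p ∷ ps) 1 refl = 0 , 1F , p , refl , refl , cong (λ k → blockStep k p 1F) (sym (+-identityʳ k))
    nth-expand⁻ k (p ∷ ps) 2 refl = 0 , 2F , p , refl , refl , cong (λ k → blockStep k p 2F) (sym (+-identityʳ k))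
    nth-expand⁻ k (p ∷ ps) 3 refl = 0 , 3F , p , refl , refl , cong (λ k → blockStep k p 3F) (sym (+-identityʳ k))
    nth-expand⁻ k (p ∷ ps) (suc (suc (suc (suc k′)))) eq =
      let (j , r , q , k′≡ , nthⱼ≡q , p′≡) = nth-expand⁻ (suc k) ps k′ eq
      in suc j , r , q , cong (λ x → suc (suc (suc (suc x)))) k′≡ , nthⱼ≡q ,
         trans p′≡ (cong (λ k → blockStep k q r) (sym (+-suc k j)))

    All-expand : ∀ {Q : ℕ × ℕ → Set} k ps → k + length ps ≤ n → All (ValidPair m) ps →
      (∀ j a b r → j < n → a < m → b < m → Q (blockStep j (a , b) r)) → All Q (expand k ps)
    All-expand k []             _         _                          _ = []
    All-expand k ((a , b) ∷ ps) k+|ps|≤n ((a<m , b<m , _) ∷ valids) q =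
      q k a b 0F k<n a<m b<m ∷ q k a b 1F k<n a<m b<m ∷ q k a b 2F k<n a<m b<m ∷ q k a b 3F k<n a<m b<m ∷
      All-expand (suc k) ps (≤-trans (≤-reflexive (sym (+-suc k (length ps)))) k+|ps|≤n) valids q
      where
      k<n : k < n
      k<n = <-≤-trans (m<m+n k (s≤s z≤n)) k+|ps|≤n

-- The reduction

source : ℕ → ℕ → ℕ → Str → Str → Input 3 2
source m n d I G = (m ∷ n ∷ d ∷ []) , (I ∷ G ∷ [])

mT nT dT : Term 3 2 v
mT = numI #0
nT = numI #1
dT = numI #2

GatePair : ℕ → Str → ℕ → Set
GatePair m G k = Σ (ℕ × ℕ) λ p → ValidPair m p × ∀ a b → (bit G ⟨ k , ⟨ a , b ⟩ ⟩ ≡ true) ⇔ (p ≡ (a , b))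

WellFormed : ℕ → ℕ → ℕ → Str → Set
WellFormed m n d G = d < m × ∀ k → k < n → GatePair m G k

GatePairF : Formula 3 2 (suc v)
GatePairF = ∃≤ mT (∃≤ mT (((one ⊕ var #1) ≤f mT) ∧f (((one ⊕ var #0) ≤f mT) ∧f ((¬f (var #1 ≡f var #0)) ∧f
  (HasTriple #1 (var #2) (var #1) (var #0) ∧f
   ∀≤ (len #1) (∀≤ (len #1) (¬f (HasTriple #1 (var #4) (var #1) (var #0)) ∨f
                             ((var #1 ≡f var #3) ∧f (var #0 ≡f var #2)))))))))

GatePairF-sem : ∀ m n d I G k (ρ : Vec ℕ v) → ⟦ GatePairF ⟧F (source m n d I G) (k ∷ ρ) ⇔ GatePair m G k
GatePairF-sem m n d I G k ρ = mk⇔ decode encode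
  where
  inp = source m n d I G
  has-ab : ∀ a b → ⟦ HasTriple #1 (var #2) (var #1) (var #0) ⟧F inp (b ∷ a ∷ k ∷ ρ) ⇔
                   (bit G ⟨ k , ⟨ a , b ⟩ ⟩ ≡ true)
  has-ab a b = HasTriple-sem #1 (var #2) (var #1) (var #0) inp (b ∷ a ∷ k ∷ ρ)
  has-a′b′ : ∀ a b a′ b′ →
    ⟦ HasTriple #1 (var #4) (var #1) (var #0) ⟧F inp (b′ ∷ a′ ∷ b ∷ a ∷ k ∷ ρ) ⇔
                           (bit G ⟨ k , ⟨ a′ , b′ ⟩ ⟩ ≡ true)
  has-a′b′ a b a′ b′ = HasTriple-sem #1 (var #4) (var #1) (var #0) inp (b′ ∷ a′ ∷ b ∷ a ∷ k ∷ ρ)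

  decode : ⟦ GatePairF ⟧F inp (k ∷ ρ) → GatePair m G k
  decode (a , _ , b , _ , a<m , b<m , a≢b , ab∈G , only-ab) =
    (a , b) , (a<m , b<m , a≢b) , λ a′ b′ → mk⇔ (only a′ b′) (λ { refl → to (has-ab a b) ab∈G })
    where
    only : ∀ a′ b′ → bit G ⟨ k , ⟨ a′ , b′ ⟩ ⟩ ≡ true → (a , b) ≡ (a′ , b′)
    only a′ b′ t∈G with triple-components≤length G k a′ b′ t∈G
    ... | _ , a′≤|G| , b′≤|G| with only-ab a′ a′≤|G| b′ b′≤|G|
    ...   | inj₁ ¬has = ⊥-elim (¬has (from (has-a′b′ a b a′ b′) t∈G))
    ...   | inj₂ (a′≡a , b′≡b) = sym (×-≡,≡→≡ (a′≡a , b′≡b))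

  encode : GatePair m G k → ⟦ GatePairF ⟧F inp (k ∷ ρ)
  encode ((a , b) , (a<m , b<m , a≢b) , spec) =
    a , <⇒≤ a<m , b , <⇒≤ b<m , a<m , b<m , a≢b , from (has-ab a b) (from (spec a b) refl) ,
    λ a′ _ b′ _ → only a′ b′
    where
    only : ∀ a′ b′ →
      ⟦ ¬f (HasTriple #1 (var #4) (var #1) (var #0)) ∨f ((var #1 ≡f var #3) ∧f (var #0 ≡f var #2)) ⟧F
        inp (b′ ∷ a′ ∷ b ∷ a ∷ k ∷ ρ)
    only a′ b′ with ⟦ HasTriple #1 (var #4) (var #1) (var #0) ⟧F? inp (b′ ∷ a′ ∷ b ∷ a ∷ k ∷ ρ)
    ... | no ¬has = inj₁ ¬has
    ... | yes has = inj₂ (×-≡,≡←≡ (sym (to (spec a′ b′) (to (has-a′b′ a b a′ b′) has))))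

WellFormedF : Formula 3 2 v
WellFormedF = ((one ⊕ dT) ≤f mT) ∧f ∀≤ nT (¬f ((one ⊕ var #0) ≤f nT) ∨f GatePairF)

WellFormedF-sem : ∀ m n d I G (ρ : Vec ℕ v) → ⟦ WellFormedF ⟧F (source m n d I G) ρ ⇔ WellFormed m n d G
WellFormedF-sem m n d I G ρ = mk⇔
  (λ (d<m , gatePairs) → d<m , λ k k<n → gatePair k (gatePairs k (<⇒≤ k<n)) k<n)
  (λ (d<m , gatePairs) → d<m , λ k _ → gatePairIfGate k gatePairs)
  where
  GatePairIfGateF : Formula 3 2 (suc v)
  GatePairIfGateF = ¬f ((one ⊕ var #0) ≤f nT) ∨f GatePairF

  gatePair : ∀ k → ⟦ GatePairIfGateF ⟧F (source m n d I G) (k ∷ ρ) → k < n → GatePair m G k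
  gatePair k (inj₁ k≮n) k<n = ⊥-elim (k≮n k<n)
  gatePair k (inj₂ has)  _   = to (GatePairF-sem m n d I G k ρ) has

  gatePairIfGate : ∀ k → (∀ k → k < n → GatePair m G k) → ⟦ GatePairIfGateF ⟧F (source m n d I G) (k ∷ ρ)
  gatePairIfGate k gatePairs with k <? n
  ... | no  k≮n = inj₁ k≮n
  ... | yes k<n = inj₂ (from (GatePairF-sem m n d I G k ρ) (gatePairs k k<n))

module Reduction (dir : Direction) where

  mainT : Term 3 2 v → Term 3 2 v
  mainT w = nT ⊕ w

  sideT : Direction → Term 3 2 v → Term 3 2 v
  sideT down j = j
  sideT up   j = (nT ⊕ mT) ⊕ j

  widthT : Term 3 2 v
  widthT = (nT ⊕ mT) ⊕ nT

  InputF : Formula 3 2 1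
  InputF = ∃≤ (var #0) ((((one ⊕ var #0) ≤f nT) ∧f (var #1 ≡f sideT dir (var #0))) ∨f
                        (((one ⊕ var #0) ≤f mT) ∧f ((var #1 ≡f mainT (var #0)) ∧f mem #0 (var #0))))

  StepAtF : Fin 4 → (k′ a′ b′ k a b : Term 3 2 v) → Formula 3 2 v
  StepAtF r k′ a′ b′ k a b =
    (k′ ≡f ((k ⊗ numeral 4) ⊕ numeral (toℕ r))) ∧f ((a′ ≡f proj₁ step) ∧f (b′ ≡f proj₂ step))
    where step = gadgetStep (mainT a) (mainT b) (sideT dir k) (sideT (opposite dir) k) r

  StepF : (k′ a′ b′ k a b : Term 3 2 v) → Formula 3 2 v
  StepF k′ a′ b′ k a b = StepAtF 0F k′ a′ b′ k a b ∨f (StepAtF 1F k′ a′ b′ k a b ∨f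
                        (StepAtF 2F k′ a′ b′ k a b ∨f StepAtF 3F k′ a′ b′ k a b))

  GateF : Formula 3 2 1
  GateF = ∃≤ (var #0) (∃≤ (var #1) (∃≤ (var #2) (IsTriple (var #3) (var #2) (var #1) (var #0) ∧f
    ∃≤ (len #1) (∃≤ (len #1) (∃≤ (len #1) (HasTriple #1 (var #2) (var #1) (var #0) ∧f
      StepF (var #5) (var #4) (var #3) (var #2) (var #1) (var #0)))))))

  gateBoundT : Term 3 2 0
  gateBoundT = one ⊕ pairBound N (pairBound N N)
    where N = (nT ⊗ numeral 4) ⊕ widthT

  module Semantics (m n d : ℕ) (I G : Str) where
    open Layout m n
    open Expansion dir

    inp = source m n d I G
    I′ = comprehension widthT InputF inp
    G′ = comprehension gateBoundT GateF inp

    ⟦sideT⟧ : ∀ dir′ (j : Term 3 2 v) ρ → ⟦ sideT dir′ j ⟧T inp ρ ≡ side dir′ (⟦ j ⟧T inp ρ)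
    ⟦sideT⟧ down j ρ = refl
    ⟦sideT⟧ up   j ρ = refl

    ⟦gadgetStep⟧ : ∀ (A B O Z : Term 3 2 v) ρ r →
      (⟦ proj₁ (gadgetStep A B O Z r) ⟧T inp ρ , ⟦ proj₂ (gadgetStep A B O Z r) ⟧T inp ρ)
      ≡ gadgetStep (⟦ A ⟧T inp ρ) (⟦ B ⟧T inp ρ) (⟦ O ⟧T inp ρ) (⟦ Z ⟧T inp ρ) r
    ⟦gadgetStep⟧ A B O Z ρ 0F = refl
    ⟦gadgetStep⟧ A B O Z ρ 1F = refl
    ⟦gadgetStep⟧ A B O Z ρ 2F = refl
    ⟦gadgetStep⟧ A B O Z ρ 3F = refl

    StepAtF-sem : ∀ r (k′ a′ b′ k a b : Term 3 2 v) ρ → ⟦ StepAtF r k′ a′ b′ k a b ⟧F inp ρ ⇔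
      (⟦ k′ ⟧T inp ρ ≡ ⟦ k ⟧T inp ρ * 4 + toℕ r ×
       (⟦ a′ ⟧T inp ρ , ⟦ b′ ⟧T inp ρ) ≡ blockStep (⟦ k ⟧T inp ρ) (⟦ a ⟧T inp ρ , ⟦ b ⟧T inp ρ) r)
    StepAtF-sem r k′ a′ b′ k a b ρ = mk⇔
      (λ (k′≡ , a′≡ , b′≡) → trans k′≡ r≡ , trans (×-≡,≡→≡ (a′≡ , b′≡)) step≡)
      (λ (k′≡ , p′≡) → trans k′≡ (sym r≡) , ×-≡,≡←≡ (trans p′≡ (sym step≡)))
      where
      K = ⟦ k ⟧T inp ρ
      r≡ : K * 4 + ⟦ numeral (toℕ r) ⟧T inp ρ ≡ K * 4 + toℕ r
      r≡ = cong (K * 4 +_) (⟦numeral⟧ (toℕ r) inp ρ)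
      step≡ = trans (⟦gadgetStep⟧ (mainT a) (mainT b) (sideT dir k) (sideT (opposite dir) k) ρ r)
                    (cong₂ (λ O Z → gadgetStep (n + ⟦ a ⟧T inp ρ) (n + ⟦ b ⟧T inp ρ) O Z r)
                           (⟦sideT⟧ dir k ρ) (⟦sideT⟧ (opposite dir) k ρ))

    StepF-sem : ∀ (k′ a′ b′ k a b : Term 3 2 v) ρ → ⟦ StepF k′ a′ b′ k a b ⟧F inp ρ ⇔
      Σ (Fin 4) λ r → ⟦ k′ ⟧T inp ρ ≡ ⟦ k ⟧T inp ρ * 4 + toℕ r ×
        (⟦ a′ ⟧T inp ρ , ⟦ b′ ⟧T inp ρ) ≡ blockStep (⟦ k ⟧T inp ρ) (⟦ a ⟧T inp ρ , ⟦ b ⟧T inp ρ) r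
    StepF-sem k′ a′ b′ k a b ρ = mk⇔
      (λ { (inj₁ s)               → 0F , to (stepAt 0F) s
         ; (inj₂ (inj₁ s))        → 1F , to (stepAt 1F) s
         ; (inj₂ (inj₂ (inj₁ s))) → 2F , to (stepAt 2F) s
         ; (inj₂ (inj₂ (inj₂ s))) → 3F , to (stepAt 3F) s })
      (λ { (0F , s) → inj₁ (from (stepAt 0F) s)
         ; (1F , s) → inj₂ (inj₁ (from (stepAt 1F) s))
         ; (2F , s) → inj₂ (inj₂ (inj₁ (from (stepAt 2F) s)))
         ; (3F , s) → inj₂ (inj₂ (inj₂ (from (stepAt 3F) s))) })
      where stepAt = λ r → StepAtF-sem r k′ a′ b′ k a b ρ

    GateSpec : ℕ → ℕ × ℕ → Set
    GateSpec k′ p′ = Σ ℕ λ k → Σ ℕ λ a → Σ ℕ λ b → bit G ⟨ k , ⟨ a , b ⟩ ⟩ ≡ true ×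
      Σ (Fin 4) λ r → k′ ≡ k * 4 + toℕ r × p′ ≡ blockStep k (a , b) r

    GateF-sem : ∀ i → ⟦ GateF ⟧F inp (i ∷ []) ⇔
      Σ ℕ λ k′ → Σ ℕ λ a′ → Σ ℕ λ b′ → i ≡ ⟨ k′ , ⟨ a′ , b′ ⟩ ⟩ × GateSpec k′ (a′ , b′)
    GateF-sem i = mk⇔
      (λ (k′ , _ , a′ , _ , b′ , _ , triple , k , _ , a , _ , b , _ , ab∈G , step) →
         k′ , a′ , b′ , to (isTriple k′ a′ b′) triple , k , a , b ,
         to (hasTriple k′ a′ b′ k a b) ab∈G , to (stepF k′ a′ b′ k a b) step)
      (λ (k′ , a′ , b′ , i≡ , k , a , b , ab∈G , step) →
         let (k′≤i , a′≤i , b′≤i) = triple-components≤ i≡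
             (k≤|G| , a≤|G| , b≤|G|) = triple-components≤length G k a b ab∈G
         in k′ , k′≤i , a′ , a′≤i , b′ , b′≤i , from (isTriple k′ a′ b′) i≡ ,
            k , k≤|G| , a , a≤|G| , b , b≤|G| ,
            from (hasTriple k′ a′ b′ k a b) ab∈G , from (stepF k′ a′ b′ k a b) step)
      where
      isTriple = λ k′ a′ b′ → IsTriple-sem (var #3) (var #2) (var #1) (var #0) inp (b′ ∷ a′ ∷ k′ ∷ i ∷ [])
      hasTriple = λ k′ a′ b′ k a b →
        HasTriple-sem #1 (var #2) (var #1) (var #0) inp (b ∷ a ∷ k ∷ b′ ∷ a′ ∷ k′ ∷ i ∷ [])
      stepF = λ k′ a′ b′ k a b →
        StepF-sem (var #5) (var #4) (var #3) (var #2) (var #1) (var #0) (b ∷ a ∷ k ∷ b′ ∷ a′ ∷ k′ ∷ i ∷ [])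

    input-simulates : Simulates 0 (bit I′) (bit I)
    input-simulates = mains , constants
      where
      bit-I′ = bit-comprehension widthT InputF inp

      mains : ∀ w → w < m → bit I′ (main w) ≡ bit I w
      mains w w<m = true-extensional
        (λ b → case-input (proj₂ (to (bit-I′ (main w)) b)))
        (λ Iw → from (bit-I′ (main w)) (main<width w<m , w , m≤n+m w n , inj₂ (w<m , refl , Iw)))
        where
        case-input : ⟦ InputF ⟧F inp (main w ∷ []) → bit I w ≡ true
        case-input (j , _ , inj₁ (j<n , w≡side)) =
          ⊥-elim (side≢main dir j<n w<m (sym (trans w≡side (⟦sideT⟧ dir (var #0) _))))
        case-input (j , _ , inj₂ (_ , w≡j , Ij)) = subst (λ w → bit I w ≡ true) (sym (main-injective w≡j)) Ij

      constants : ∀ j → 0 ≤ j → j < n → bit I′ (oneWire j) ≡ true × bit I′ (zeroWire j) ≡ false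
      constants j _ j<n = one≡1 , Bool.¬-not (λ b → case-input (proj₂ (to (bit-I′ (zeroWire j)) b)))
        where
        one≡1 = from (bit-I′ (oneWire j))
          (side<width dir j<n , j , j≤side dir j , inj₁ (j<n , sym (⟦sideT⟧ dir (var #0) (j ∷ oneWire j ∷ []))))
        case-input : ¬ ⟦ InputF ⟧F inp (zeroWire j ∷ [])
        case-input (j′ , _ , inj₁ (j′<n , zero≡side)) =
          side≢opposite dir j′<n j<n (sym (trans zero≡side (⟦sideT⟧ dir (var #0) _)))
        case-input (j′ , _ , inj₂ (j′<m , zero≡main , _)) = side≢main (opposite dir) j<n j′<m zero≡main

    gate<gateBound : ∀ {k′ a′ b′} → k′ < n * 4 → a′ < width → b′ < width →
      ⟨ k′ , ⟨ a′ , b′ ⟩ ⟩ < ⟦ gateBoundT ⟧T inp []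
    gate<gateBound {k′} {a′} {b′} k′<n*4 a′<width b′<width = s≤s (begin
      ⟨ k′ , ⟨ a′ , b′ ⟩ ⟩ ≤⟨ ⟨⟩-mono-≤ (≤N k′<n*4 (m≤m+n (n * 4) width))
                                       (⟨⟩-mono-≤ (≤N a′<width N≥width) (≤N b′<width N≥width)) ⟩
      ⟨ N , ⟨ N , N ⟩ ⟩    ≤⟨ ⟨⟩-mono-≤ (≤-refl {N}) (⟨x,y⟩≤[x+y]²+y N N) ⟩
      ⟨ N , Q ⟩            ≤⟨ ⟨x,y⟩≤[x+y]²+y N Q ⟩
      (N + Q) * (N + Q) + Q ∎)
      where
      open ≤-Reasoning
      N = n * 4 + width
      Q = (N + N) * (N + N) + N
      N≥width = m≤n+m width (n * 4)
      ≤N : ∀ {x y} → x < y → y ≤ N → x ≤ N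
      ≤N x<y y≤N = ≤-trans (<⇒≤ x<y) y≤N

    expand-encoded : ∀ ps → Encodes G ps → length ps ≤ n → All (ValidPair m) ps → Encodes G′ (expand 0 ps)
    expand-encoded ps enc |ps|≤n valid k′ {p′} nth≡p′ a′ b′ = encodedAt (nth-expand⁻ 0 ps k′ nth≡p′)
      where
      bit-G′ = bit-comprehension gateBoundT GateF inp ⟨ k′ , ⟨ a′ , b′ ⟩ ⟩

      encodedAt : (Σ ℕ λ j → Σ (Fin 4) λ r → Σ (ℕ × ℕ) λ x →
                     k′ ≡ j * 4 + toℕ r × nth ps j ≡ just x × p′ ≡ blockStep j x r) →
                  (bit G′ ⟨ k′ , ⟨ a′ , b′ ⟩ ⟩ ≡ true) ⇔ (p′ ≡ (a′ , b′))
      encodedAt (j , r , x , k′≡ , nthⱼ≡x , p′≡) =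
        mk⇔ (λ t∈G′ → decode (to (GateF-sem _) (proj₂ (to bit-G′ t∈G′)))) encode
        where
        decode : (Σ ℕ λ k″ → Σ ℕ λ a″ → Σ ℕ λ b″ →
                    ⟨ k′ , ⟨ a′ , b′ ⟩ ⟩ ≡ ⟨ k″ , ⟨ a″ , b″ ⟩ ⟩ × GateSpec k″ (a″ , b″)) →
                 p′ ≡ (a′ , b′)
        decode (k″ , a″ , b″ , t≡ , k , a , b , ab∈G , r′ , k″≡ , p″≡)
          with ⟨⟩-injective {k′} {⟨ a′ , b′ ⟩} {k″} {⟨ a″ , b″ ⟩} t≡
        ... | refl , pair≡ with ⟨⟩-injective {a′} {b′} {a″} {b″} pair≡
        ... | refl , refl with j*4+r-injective j k r r′ (trans (sym k′≡) k″≡)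
        ... | refl , refl with to (enc j nthⱼ≡x a b) ab∈G
        ... | refl = trans p′≡ (sym p″≡)

        encode : p′ ≡ (a′ , b′) → bit G′ ⟨ k′ , ⟨ a′ , b′ ⟩ ⟩ ≡ true
        encode refl = from bit-G′ (bound , from (GateF-sem _)
          (k′ , a′ , b′ , refl , j , proj₁ x , proj₂ x , from (enc j nthⱼ≡x _ _) refl , r , k′≡ , p′≡))
          where
          j<n : j < n
          j<n = <-≤-trans (nth⇒< ps j nthⱼ≡x) |ps|≤n
          x-valid = All-nth ps j valid nthⱼ≡x
          p′-valid = subst (ValidPair width) (sym p′≡)
            (blockStep-valid (proj₁ x) (proj₂ x) r j<n (proj₁ x-valid) (proj₁ (proj₂ x-valid)))
          bound = gate<gateBound (subst (_< n * 4) (sym k′≡) (j*4+r<n*4 r j<n))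
                                 (proj₁ p′-valid) (proj₁ (proj₂ p′-valid))

    simulation-output : ∀ ps → length ps ≤ n → All (ValidPair m) ps → d < m →
      evaluate (expand 0 ps) (bit I′) (main d) ≡ evaluate ps (bit I) d
    simulation-output ps |ps|≤n valid d<m =
      proj₁ (expand-simulates ps 0 (bit I′) (bit I) |ps|≤n valid input-simulates) d d<m

    wellFormed : d < m → ∀ ps → Encodes G ps → length ps ≡ n → All (ValidPair m) ps → WellFormed m n d G
    wellFormed d<m ps enc |ps|≡n valid = d<m , λ k k<n →
      let (p , nthₖ≡p) = <⇒nth ps k (subst (k <_) (sym |ps|≡n) k<n)
      in p , All-nth ps k valid nthₖ≡p , enc k nthₖ≡p

    target : ℕ → Input 3 2
    target m′ = (m′ ∷ n * 4 ∷ n + d ∷ []) , (I′ ∷ G′ ∷ [])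

    ccv⇒target : Ccv inp → WellFormed m n d G × CcvWith (Points dir) (target width)
    ccv⇒target (d<m , gs , |gs|≡n , enc , _ , out) =
      wellFormed d<m ps encG |ps|≡n valid ,
      main<width d<m , gs′ , |gs′|≡n*4 , gates-encoded G′ qs valid′ (expand-encoded ps encG |ps|≤n valid) ,
      gates-points dir qs valid′ (All-expand 0 ps |ps|≤n valid (λ j a b r → blockStep-oriented a b r)) , output
      where
      ps = network gs
      valid = network-valid gs
      |ps|≡n = trans (length-map endpoints gs) |gs|≡n
      |ps|≤n = ≤-reflexive |ps|≡n
      encG = GatesEncoded⇒Encodes G gs enc
      qs = expand 0 ps
      valid′ : All (ValidPair width) qs
      valid′ = All-expand 0 ps |ps|≤n valid (λ j a b r → blockStep-valid a b r)
      gs′ = gates qs valid′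
      |gs′|≡n*4 = trans (length-gates qs valid′) (trans (length-expand 0 ps) (cong (_* 4) |ps|≡n))
      output : run gs′ (λ w → bit I′ (toℕ w)) (fromℕ< (main<width d<m)) ≡ true
      output = begin
        run gs′ (λ w → bit I′ (toℕ w)) (fromℕ< (main<width d<m))
          ≡⟨ run≡evaluate-network gs′ I′ (main<width d<m) ⟩
        evaluate (network gs′) (bit I′) (main d)
          ≡⟨ cong (λ qs → evaluate qs (bit I′) (main d)) (network-gates qs valid′) ⟩
        evaluate qs (bit I′) (main d)
          ≡⟨ simulation-output ps |ps|≤n valid d<m ⟩
        evaluate ps (bit I) d
          ≡⟨ sym (run≡evaluate-network gs I d<m) ⟩
        run gs (λ w → bit I (toℕ w)) (fromℕ< d<m)
          ≡⟨ out ⟩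
        true ∎
        where open ≡-Reasoning

    target⇒ccv : WellFormed m n d G → CcvWith (Points dir) (target width) → Ccv inp
    target⇒ccv (d<m , gatePairs) (d′<width , gs′ , |gs′|≡n*4 , enc′ , _ , out′) =
      d<m , gs , trans (length-gates ps valid) |ps|≡n , gates-encoded G ps valid encG ,
      All.universal (λ _ → tt) gs , output
      where
      ps = tabulate< n (λ k k<n → proj₁ (gatePairs k k<n))
      |ps|≡n = length-tabulate< n _
      |ps|≤n = ≤-reflexive |ps|≡n
      valid = All-tabulate< n _ (λ k k<n → proj₁ (proj₂ (gatePairs k k<n)))
      encG : Encodes G ps
      encG k nthₖ≡p with nth-tabulate< n _ k nthₖ≡p
      ... | k<n , refl = proj₂ (proj₂ (gatePairs k k<n))
      gs = gates ps valid
      network-gs′ : network gs′ ≡ expand 0 ps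
      network-gs′ = Encodes-unique G′ (network gs′) (expand 0 ps)
        (GatesEncoded⇒Encodes G′ gs′ enc′) (expand-encoded ps encG |ps|≤n valid)
        (trans (length-map endpoints gs′) (trans |gs′|≡n*4 (sym (trans (length-expand 0 ps) (cong (_* 4) |ps|≡n)))))
      output : run gs (λ w → bit I (toℕ w)) (fromℕ< d<m) ≡ true
      output = begin
        run gs (λ w → bit I (toℕ w)) (fromℕ< d<m)
          ≡⟨ run≡evaluate-network gs I d<m ⟩
        evaluate (network gs) (bit I) d
          ≡⟨ cong (λ ps → evaluate ps (bit I) d) (network-gates ps valid) ⟩
        evaluate ps (bit I) d
          ≡⟨ sym (simulation-output ps |ps|≤n valid d<m) ⟩
        evaluate (expand 0 ps) (bit I′) (main d)
          ≡⟨ cong (λ qs → evaluate qs (bit I′) (main d)) (sym network-gs′) ⟩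
        evaluate (network gs′) (bit I′) (main d)
          ≡⟨ sym (run≡evaluate-network gs′ I′ d′<width) ⟩
        run gs′ (λ w → bit I′ (toℕ w)) (fromℕ< d′<width)
          ≡⟨ out′ ⟩
        true ∎
        where open ≡-Reasoning

  reduce : Input 3 2 → Input 3 2
  reduce inp = (ifHolds WellFormedF widthT inp ∷ ⟦ nT ⊗ numeral 4 ⟧T inp [] ∷ ⟦ nT ⊕ dT ⟧T inp [] ∷ []) ,
               (comprehension widthT InputF inp ∷ comprehension gateBoundT GateF inp ∷ [])

  reduce-AC0 : IsAC0 reduce
  reduce-AC0 =
    (λ { #0 → ifHolds-AC0Num WellFormedF widthT WellFormedF-closed
       ; #1 → term-AC0Num (nT ⊗ numeral 4)
       ; #2 → term-AC0Num (nT ⊕ dT) }) ,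
    (λ { #0 → comprehension-AC0Str widthT InputF
       ; #1 → comprehension-AC0Str gateBoundT GateF })
    where
    WellFormedF-closed : ∀ inp y → ⟦ WellFormedF ⟧F inp (y ∷ []) ⇔ ⟦ WellFormedF ⟧F inp []
    WellFormedF-closed ((m ∷ n ∷ d ∷ []) , (I ∷ G ∷ [])) y =
      ⇔.trans (WellFormedF-sem m n d I G (y ∷ [])) (⇔.sym (WellFormedF-sem m n d I G []))

  reduce-correct : ∀ inp → Ccv inp ⇔ CcvWith (Points dir) (reduce inp)
  reduce-correct ((m ∷ n ∷ d ∷ []) , (I ∷ G ∷ [])) = correct (⟦ WellFormedF ⟧F? inp [])
    where
    open Semantics m n d I G
    correct : (wf? : Dec (⟦ WellFormedF ⟧F inp [])) →
      Ccv inp ⇔ CcvWith (Points dir) (target (if does wf? then Layout.width m n else 0))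
    correct (yes wf) = mk⇔ (λ ccv → proj₂ (ccv⇒target ccv)) (target⇒ccv (to (WellFormedF-sem m n d I G []) wf))
    correct (no ¬wf) = mk⇔ (λ ccv → ⊥-elim (¬wf (from (WellFormedF-sem m n d I G []) (proj₁ (ccv⇒target ccv)))))
                           (λ { (() , _) })

proposition2 : (Ccv ≤AC0 Ccv↓) × (Ccv ≤AC0 Ccv↑)
proposition2 = reduction down , reduction up
  where
  reduction : ∀ dir → Ccv ≤AC0 CcvWith (Points dir)
  reduction dir = reduce , reduce-AC0 , reduce-correct
    where open Reduction dir
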